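{- For all positive integers $n,d$, $$\mathrm{nnz}(V(n,d))=\sum_{k=1}^{\min\{n,d\}}\binom{n}{k}\binom{d-1}{k-1}\binom{d+k-1}{d},\qquad \mathrm{spa}(V(n,d))=1-\frac{\mathrm{nnz}(V(n,d))}{\binom{n+d-1}{d}^2}.$$
   Context: $\mathbb{N}=\{0,1,2,\dots\}$; $B(n,d)=\{\alpha\in\mathbb{N}^n:\sum_i\alpha_i=d\}$ enumerated as $\alpha^1,\dots,\alpha^{s}$ with $s=\binom{n+d-1}{d}$; $V(n,d)=[(\alpha^i)^{\alpha^j}]_{i,j}$ where $\alpha^{\beta}=\prod_k\alpha_k^{\beta_k}$ and $0^0=1$. For a matrix $M\in\mathbb{R}^{p\times m}$, $\mathrm{nnz}(M)$ is the number of nonzero entries and $\mathrm{spa}(M)=1-\mathrm{nnz}(M)/(pm)$. -}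

module Defs where

open import Data.Nat using (ℕ; zero; suc; _+_; _*_; _^_; _≟_)
open import Data.Integer using (+_)
open import Data.Rational using (ℚ; _/_; 0ℚ; 1ℚ; _-_)
open import Data.Fin using (Fin)
open import Data.Vec using (Vec; []; _∷_; foldr)
open import Data.List using (List; []; _∷_; length; map; concatMap; filter; upTo; allFin; lookup)
open import Data.Nat.ListAction using (sum)
open import Relation.Nullary.Decidable using (does)
open import Data.Bool using (if_then_else_)

boxVecs : (n d : ℕ) → List (Vec ℕ n)
boxVecs zero d = [] ∷ []
boxVecs (suc n) d = concatMap (λ a → map (a ∷_) (boxVecs n d)) (upTo (suc d))

vsum : {n : ℕ} → Vec ℕ n → ℕ
vsum = foldr _ _+_ 0

-- B(n,d) = { α ∈ ℕ^n : Σ α_i = d }, enumerated as a list (without repetitions)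
B : (n d : ℕ) → List (Vec ℕ n)
B n d = filter (λ α → vsum α ≟ d) (boxVecs n d)

-- α^β = ∏_k α_k^{β_k}, with 0^0 = 1 (as in Data.Nat._^_)
vpow : {n : ℕ} → Vec ℕ n → Vec ℕ n → ℕ
vpow [] [] = 1
vpow (a ∷ α) (b ∷ β) = a ^ b * vpow α β

V : (n d : ℕ) → Fin (length (B n d)) → Fin (length (B n d)) → ℕ
V n d i j = vpow (lookup (B n d) i) (lookup (B n d) j)

nnz : {p m : ℕ} → (Fin p → Fin m → ℕ) → ℕ
nnz {p} {m} M =
  sum (map (λ i → sum (map (λ j → if does (M i j ≟ 0) then 0 else 1) (allFin m))) (allFin p))

-- a / b as a rational; convention a / 0 = 0 (never used with b = 0 below)
frac : ℕ → ℕ → ℚ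
frac a zero = 0ℚ
frac a (suc b) = (+ a) / suc b

spa : {p m : ℕ} → (Fin p → Fin m → ℕ) → ℚ
spa {p} {m} M = 1ℚ - frac (nnz M) (p * m)

{-# OPTIONS --safe #-}
-- The entry α^β is nonzero exactly when supp β ⊆ supp α. If α has k nonzero
-- entries, the β ∈ B(n,d) supported there are the weak compositions of d into
-- k parts, of which there are C(d+k-1, d); and the α ∈ B(n,d) with exactly k
-- nonzero entries number C(n,k) C(d-1,k-1) (a support, then a composition of
-- d into k positive parts). Grouping the α by k gives the formula for nnz,
-- and |B(n,d)| is itself the number of weak compositions of d into n parts.
module Submission where

open import Defs
open import Data.Nat using (ℕ; zero; suc; _+_; _*_; _∸_; _^_; _≤_; _<_; _⊓_; _≟_; z≤n; s≤s)
open import Data.Nat.Properties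
open import Data.Nat.Combinatorics using (_C_; nCn≡1; k>n⇒nCk≡0; nCk+nC[k+1]≡[n+1]C[k+1])
open import Data.Nat.ListAction using (sum)
open import Data.Nat.ListAction.Properties using (sum-++)
open import Data.List using (List; []; _∷_; _++_; map; upTo; applyUpTo; length; filter; concatMap; tabulate; allFin; lookup)
open import Data.List.Properties using (map-++; map-cong; map-∘; map-tabulate; map-applyUpTo)
open import Data.Vec using (Vec; []; _∷_)
open import Data.Rational using (1ℚ; _-_)
open import Data.Product using (_×_; _,_)
open import Data.Sum using (inj₁; inj₂)
open import Data.Bool using (false; true; if_then_else_)
open import Function using (_∘_; id)
open import Relation.Nullary.Decidable using (does)
open import Relation.Unary using (Pred; Decidable)
open import Level using (0ℓ)
open import Relation.Binary.PropositionalEquality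
open import Algebra.Properties.CommutativeSemigroup +-commutativeSemigroup using (interchange)

-- Sums over initial segments of ℕ

Σ : ℕ → (ℕ → ℕ) → ℕ
Σ zero    f = 0
Σ (suc m) f = f 0 + Σ m (f ∘ suc)

Σ-cong : ∀ m {f g : ℕ → ℕ} → (∀ i → i < m → f i ≡ g i) → Σ m f ≡ Σ m g
Σ-cong zero    f≡g = refl
Σ-cong (suc m) f≡g = cong₂ _+_ (f≡g 0 (s≤s z≤n)) (Σ-cong m (λ i i<m → f≡g (suc i) (s≤s i<m)))

Σ-≡0 : ∀ m {f : ℕ → ℕ} → (∀ i → f i ≡ 0) → Σ m f ≡ 0
Σ-≡0 zero    f≡0 = refl
Σ-≡0 (suc m) f≡0 = cong₂ _+_ (f≡0 0) (Σ-≡0 m (f≡0 ∘ suc))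

Σ-last : ∀ m (f : ℕ → ℕ) → Σ (suc m) f ≡ Σ m f + f m
Σ-last zero    f = +-comm (f 0) 0
Σ-last (suc m) f = trans (cong (f 0 +_) (Σ-last m (f ∘ suc))) (sym (+-assoc (f 0) _ _))

Σ-truncate : ∀ m k {f : ℕ → ℕ} → k ≤ m → (∀ i → k ≤ i → f i ≡ 0) → Σ m f ≡ Σ k f
Σ-truncate m       zero    _         f≡0 = Σ-≡0 m (λ i → f≡0 i z≤n)
Σ-truncate (suc m) (suc k) (s≤s k≤m) f≡0 =
  cong (_ +_) (Σ-truncate m k k≤m (λ i k≤i → f≡0 (suc i) (s≤s k≤i)))

Σ-distrib-+ : ∀ m (f g : ℕ → ℕ) → Σ m (λ i → f i + g i) ≡ Σ m f + Σ m g
Σ-distrib-+ zero    f g = refl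
Σ-distrib-+ (suc m) f g =
  trans (cong (f 0 + g 0 +_) (Σ-distrib-+ m (f ∘ suc) (g ∘ suc))) (interchange (f 0) (g 0) _ _)

Σ-comm : ∀ m k (f : ℕ → ℕ → ℕ) → Σ m (λ i → Σ k (f i)) ≡ Σ k (λ j → Σ m (λ i → f i j))
Σ-comm zero    k f = sym (Σ-≡0 k (λ _ → refl))
Σ-comm (suc m) k f =
  trans (cong (Σ k (f 0) +_) (Σ-comm m k (f ∘ suc))) (sym (Σ-distrib-+ k (f 0) _))

*-distribˡ-Σ : ∀ c m (f : ℕ → ℕ) → c * Σ m f ≡ Σ m (λ i → c * f i)
*-distribˡ-Σ c zero    f = *-zeroʳ c
*-distribˡ-Σ c (suc m) f = trans (*-distribˡ-+ c (f 0) _) (cong (c * f 0 +_) (*-distribˡ-Σ c m (f ∘ suc)))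

*-distribʳ-Σ : ∀ c m (f : ℕ → ℕ) → Σ m f * c ≡ Σ m (λ i → f i * c)
*-distribʳ-Σ c zero    f = refl
*-distribʳ-Σ c (suc m) f = trans (*-distribʳ-+ c (f 0) _) (cong (f 0 * c +_) (*-distribʳ-Σ c m (f ∘ suc)))

sum-applyUpTo : ∀ m (f : ℕ → ℕ) → sum (applyUpTo f m) ≡ Σ m f
sum-applyUpTo zero    f = refl
sum-applyUpTo (suc m) f = cong (f 0 +_) (sum-applyUpTo m (f ∘ suc))

sum-map-upTo : ∀ m (f : ℕ → ℕ) → sum (map f (upTo m)) ≡ Σ m f
sum-map-upTo m f = trans (cong sum (map-applyUpTo id f m)) (sum-applyUpTo m f)

Σ-pascal : ∀ n (g : ℕ → ℕ) →
  Σ (suc n) (λ k → (n C k) * g k) + Σ (suc n) (λ k → (n C k) * g (suc k))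
    ≡ Σ (suc (suc n)) (λ k → (suc n C k) * g k)
Σ-pascal n g = begin
  (c₀ + T) + S   ≡⟨ cong (λ t → (c₀ + t) + S) extendT ⟩
  (c₀ + T′) + S  ≡⟨ +-assoc c₀ T′ S ⟩
  c₀ + (T′ + S)  ≡⟨ cong (c₀ +_) (+-comm T′ S) ⟩
  c₀ + (S + T′)  ≡⟨ cong (c₀ +_) (sym (Σ-distrib-+ (suc n) (λ k → (n C k) * g (suc k)) (λ k → (n C suc k) * g (suc k)))) ⟩
  c₀ + Σ (suc n) (λ k → (n C k) * g (suc k) + (n C suc k) * g (suc k))
                 ≡⟨ cong (c₀ +_) (Σ-cong (suc n) (λ k _ → pascal k)) ⟩
  c₀ + Σ (suc n) (λ k → (suc n C suc k) * g (suc k)) ∎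
  where
  open ≡-Reasoning
  c₀ = (n C 0) * g 0
  T  = Σ n       (λ k → (n C suc k) * g (suc k))
  T′ = Σ (suc n) (λ k → (n C suc k) * g (suc k))
  S  = Σ (suc n) (λ k → (n C k) * g (suc k))
  extendT : T ≡ T′
  extendT = sym (begin
    T′                                   ≡⟨ Σ-last n _ ⟩
    T + (n C suc n) * g (suc n)            ≡⟨ cong (λ c → T + c * g (suc n)) (k>n⇒nCk≡0 (n<1+n n)) ⟩
    T + 0                                ≡⟨ +-identityʳ T ⟩
    T                                    ∎)
  pascal : ∀ k → (n C k) * g (suc k) + (n C suc k) * g (suc k) ≡ (suc n C suc k) * g (suc k)
  pascal k = trans (sym (*-distribʳ-+ (g (suc k)) (n C k) _))
                   (cong (_* g (suc k)) (nCk+nC[k+1]≡[n+1]C[k+1] n k))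

sum-concatMap : ∀ {A B : Set} (h : B → ℕ) (g : A → List B) xs →
  sum (map h (concatMap g xs)) ≡ sum (map (sum ∘ map h ∘ g) xs)
sum-concatMap h g []       = refl
sum-concatMap h g (x ∷ xs) = begin
  sum (map h (g x ++ concatMap g xs))             ≡⟨ cong sum (map-++ h (g x) _) ⟩
  sum (map h (g x) ++ map h (concatMap g xs))     ≡⟨ sum-++ (map h (g x)) _ ⟩
  sum (map h (g x)) + sum (map h (concatMap g xs)) ≡⟨ cong (sum (map h (g x)) +_) (sum-concatMap h g xs) ⟩
  sum (map h (g x)) + sum (map (sum ∘ map h ∘ g) xs) ∎
  where open ≡-Reasoning

sum-map-filter : ∀ {A : Set} {P : Pred A 0ℓ} (P? : Decidable P) (h : A → ℕ) xs →
  sum (map h (filter P? xs)) ≡ sum (map (λ x → if does (P? x) then h x else 0) xs)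
sum-map-filter P? h []       = refl
sum-map-filter P? h (x ∷ xs) with does (P? x)
... | false = sum-map-filter P? h xs
... | true  = cong (h x +_) (sum-map-filter P? h xs)

length≡sum-map-1 : ∀ {A : Set} (xs : List A) → length xs ≡ sum (map (λ _ → 1) xs)
length≡sum-map-1 []       = refl
length≡sum-map-1 (x ∷ xs) = cong suc (length≡sum-map-1 xs)

sum-map-≡0 : ∀ {A : Set} {h : A → ℕ} (xs : List A) → (∀ x → h x ≡ 0) → sum (map h xs) ≡ 0
sum-map-≡0 []       h≡0 = refl
sum-map-≡0 (x ∷ xs) h≡0 = cong₂ _+_ (h≡0 x) (sum-map-≡0 xs h≡0)

sum-map-lookup : ∀ {A : Set} (h : A → ℕ) (xs : List A) →
  sum (map (h ∘ lookup xs) (allFin (length xs))) ≡ sum (map h xs)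
sum-map-lookup h xs = cong sum (trans (map-tabulate id (h ∘ lookup xs)) (tabulate-∘-lookup xs))
  where
  tabulate-∘-lookup : ∀ ys → tabulate (h ∘ lookup ys) ≡ map h ys
  tabulate-∘-lookup []       = refl
  tabulate-∘-lookup (y ∷ ys) = cong (h y ∷_) (tabulate-∘-lookup ys)

-- Sums over the box {0,…,D}ⁿ and over its slices |β| = q

boxSum : (n D : ℕ) → (Vec ℕ n → ℕ) → ℕ
boxSum n D h = sum (map h (boxVecs n D))

boxSum-suc : ∀ n D (h : Vec ℕ (suc n) → ℕ) →
  boxSum (suc n) D h ≡ Σ (suc D) (λ b → boxSum n D (h ∘ (b ∷_)))
boxSum-suc n D h = begin
  sum (map h (concatMap (λ b → map (b ∷_) (boxVecs n D)) (upTo (suc D))))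
    ≡⟨ sum-concatMap h (λ b → map (b ∷_) (boxVecs n D)) (upTo (suc D)) ⟩
  sum (map (λ b → sum (map h (map (b ∷_) (boxVecs n D)))) (upTo (suc D)))
    ≡⟨ sum-map-upTo (suc D) _ ⟩
  Σ (suc D) (λ b → sum (map h (map (b ∷_) (boxVecs n D))))
    ≡⟨ Σ-cong (suc D) (λ b _ → cong sum (sym (map-∘ {g = h} {f = b ∷_} (boxVecs n D)))) ⟩
  Σ (suc D) (λ b → boxSum n D (h ∘ (b ∷_))) ∎
  where open ≡-Reasoning

levelSum : (n D q : ℕ) → (Vec ℕ n → ℕ) → ℕ
levelSum n D q h = boxSum n D (λ β → if does (vsum β ≟ q) then h β else 0)

levelSum-cong : ∀ n D q {h h′ : Vec ℕ n → ℕ} → (∀ β → h β ≡ h′ β) → levelSum n D q h ≡ levelSum n D q h′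
levelSum-cong n D q h≡h′ =
  cong sum (map-cong (λ β → cong (λ t → if does (vsum β ≟ q) then t else 0) (h≡h′ β)) (boxVecs n D))

if-then-≡0 : ∀ b {x : ℕ} → x ≡ 0 → (if b then x else 0) ≡ 0
if-then-≡0 false _   = refl
if-then-≡0 true  x≡0 = x≡0

levelSum-≡0 : ∀ n D q {h : Vec ℕ n → ℕ} → (∀ β → h β ≡ 0) → levelSum n D q h ≡ 0
levelSum-≡0 n D q h≡0 = sum-map-≡0 (boxVecs n D) (λ β → if-then-≡0 _ (h≡0 β))

does[b+s≟q]≡does[s≟q∸b] : ∀ b q s → b ≤ q → does (b + s ≟ q) ≡ does (s ≟ q ∸ b)
does[b+s≟q]≡does[s≟q∸b] zero    q       s _         = refl
does[b+s≟q]≡does[s≟q∸b] (suc b) (suc q) s (s≤s b≤q) = does[b+s≟q]≡does[s≟q∸b] b q s b≤q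

does[b+s≟q]≡false : ∀ b q s → q < b → does (b + s ≟ q) ≡ false
does[b+s≟q]≡false (suc b) zero    s _         = refl
does[b+s≟q]≡false (suc b) (suc q) s (s≤s q<b) = does[b+s≟q]≡false b q s q<b

-- q ≤ D makes the first coordinate range over all of 0,…,q.
levelSum-suc : ∀ n D q (h : Vec ℕ (suc n) → ℕ) → q ≤ D →
  levelSum (suc n) D q h ≡ Σ (suc q) (λ b → levelSum n D (q ∸ b) (h ∘ (b ∷_)))
levelSum-suc n D q h q≤D = begin
  levelSum (suc n) D q h
    ≡⟨ boxSum-suc n D _ ⟩
  Σ (suc D) (λ b → boxSum n D (λ β → if does (b + vsum β ≟ q) then h (b ∷ β) else 0))
    ≡⟨ Σ-truncate (suc D) (suc q) (s≤s q≤D) (λ b q<b →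
         sum-map-≡0 (boxVecs n D) (λ β → cong (if_then h (b ∷ β) else 0) (does[b+s≟q]≡false b q (vsum β) q<b))) ⟩
  Σ (suc q) (λ b → boxSum n D (λ β → if does (b + vsum β ≟ q) then h (b ∷ β) else 0))
    ≡⟨ Σ-cong (suc q) (λ b b<1+q → cong sum (map-cong (λ β →
         cong (if_then h (b ∷ β) else 0) (does[b+s≟q]≡does[s≟q∸b] b q (vsum β) (≤-pred b<1+q))) (boxVecs n D))) ⟩
  Σ (suc q) (λ b → levelSum n D (q ∸ b) (h ∘ (b ∷_))) ∎
  where open ≡-Reasoning

-- Supports and compositions

nonzero : ℕ → ℕ
nonzero x = if does (x ≟ 0) then 0 else 1

nonzero-suc-* : ∀ a x → nonzero (suc a * x) ≡ nonzero x
nonzero-suc-* a zero    = cong nonzero (*-zeroʳ (suc a))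
nonzero-suc-* a (suc x) = refl

nonzero-^-* : ∀ a b x → nonzero (suc a ^ b * x) ≡ nonzero x
nonzero-^-* a zero    x = cong nonzero (*-identityˡ x)
nonzero-^-* a (suc b) x = begin
  nonzero (suc a * suc a ^ b * x)   ≡⟨ cong nonzero (*-assoc (suc a) (suc a ^ b) x) ⟩
  nonzero (suc a * (suc a ^ b * x)) ≡⟨ nonzero-suc-* a (suc a ^ b * x) ⟩
  nonzero (suc a ^ b * x)           ≡⟨ nonzero-^-* a b x ⟩
  nonzero x                         ∎
  where open ≡-Reasoning

support : ∀ {n} → Vec ℕ n → ℕ
support []          = 0
support (zero  ∷ α) = support α
support (suc _ ∷ α) = suc (support α)

weakCompositions : ℕ → ℕ → ℕ
weakCompositions zero    zero    = 1
weakCompositions zero    (suc q) = 0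
weakCompositions (suc k) q       = Σ (suc q) (λ b → weakCompositions k (q ∸ b))

compositions : ℕ → ℕ → ℕ
compositions zero    zero    = 1
compositions zero    (suc p) = 0
compositions (suc k) p       = Σ p (λ a → compositions k (p ∸ suc a))

weakCompositions[k,0]≡1 : ∀ k → weakCompositions k 0 ≡ 1
weakCompositions[k,0]≡1 zero    = refl
weakCompositions[k,0]≡1 (suc k) = trans (+-identityʳ _) (weakCompositions[k,0]≡1 k)

weakCompositions[1+k,q]≡[q+k]Cq : ∀ k q → weakCompositions (suc k) q ≡ (q + k) C q
weakCompositions[1+k,q]≡[q+k]Cq k       zero    = weakCompositions[k,0]≡1 (suc k)
weakCompositions[1+k,q]≡[q+k]Cq zero    (suc q) = begin
  weakCompositions 1 q  ≡⟨ weakCompositions[1+k,q]≡[q+k]Cq 0 q ⟩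
  (q + 0) C q           ≡⟨ cong (_C q) (+-identityʳ q) ⟩
  q C q                 ≡⟨ trans (nCn≡1 q) (sym (nCn≡1 (suc q))) ⟩
  suc q C suc q         ≡⟨ cong (_C suc q) (sym (+-identityʳ (suc q))) ⟩
  (suc q + 0) C suc q   ∎
  where open ≡-Reasoning
weakCompositions[1+k,q]≡[q+k]Cq (suc k) (suc q) = begin
  weakCompositions (suc k) (suc q) + weakCompositions (suc (suc k)) q
    ≡⟨ cong₂ _+_ (weakCompositions[1+k,q]≡[q+k]Cq k (suc q)) (weakCompositions[1+k,q]≡[q+k]Cq (suc k) q) ⟩
  (suc q + k) C suc q + (q + suc k) C q
    ≡⟨ +-comm ((suc q + k) C suc q) _ ⟩
  (q + suc k) C q + (suc q + k) C suc q
    ≡⟨ cong (λ m → (q + suc k) C q + m C suc q) (sym (+-suc q k)) ⟩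
  (q + suc k) C q + (q + suc k) C suc q
    ≡⟨ nCk+nC[k+1]≡[n+1]C[k+1] (q + suc k) q ⟩
  suc (q + suc k) C suc q ∎
  where open ≡-Reasoning

compositions[1+k,1+p]≡pCk : ∀ k p → compositions (suc k) (suc p) ≡ p C k
compositions[1+k,1+p]≡pCk zero    zero    = refl
compositions[1+k,1+p]≡pCk (suc k) zero    = refl
compositions[1+k,1+p]≡pCk zero    (suc p) = compositions[1+k,1+p]≡pCk zero p
compositions[1+k,1+p]≡pCk (suc k) (suc p) =
  trans (cong₂ _+_ (compositions[1+k,1+p]≡pCk k p) (compositions[1+k,1+p]≡pCk (suc k) p))
        (nCk+nC[k+1]≡[n+1]C[k+1] p k)

levelSum-1 : ∀ n D q → q ≤ D → levelSum n D q (λ _ → 1) ≡ weakCompositions n q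
levelSum-1 zero    D zero    _   = refl
levelSum-1 zero    D (suc q) _   = refl
levelSum-1 (suc n) D q       q≤D = trans (levelSum-suc n D q _ q≤D)
  (Σ-cong (suc q) (λ b _ → levelSum-1 n D (q ∸ b) (≤-trans (m∸n≤m q b) q≤D)))

levelSum-nonzero-vpow : ∀ n D (α : Vec ℕ n) q → q ≤ D →
  levelSum n D q (nonzero ∘ vpow α) ≡ weakCompositions (support α) q
levelSum-nonzero-vpow zero    D []          zero    _   = refl
levelSum-nonzero-vpow zero    D []          (suc q) _   = refl
levelSum-nonzero-vpow (suc n) D (zero ∷ α)  q       q≤D = begin
  levelSum (suc n) D q (nonzero ∘ vpow (0 ∷ α))
    ≡⟨ levelSum-suc n D q _ q≤D ⟩
  Σ (suc q) (λ b → levelSum n D (q ∸ b) (λ β → nonzero (0 ^ b * vpow α β)))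
    ≡⟨ cong₂ _+_ b≡0 (Σ-≡0 q (λ b → levelSum-≡0 n D (q ∸ suc b) (λ β → refl))) ⟩
  weakCompositions (support α) q + 0
    ≡⟨ +-identityʳ _ ⟩
  weakCompositions (support α) q ∎
  where
  open ≡-Reasoning
  b≡0 : levelSum n D q (λ β → nonzero (1 * vpow α β)) ≡ weakCompositions (support α) q
  b≡0 = trans (levelSum-cong n D q (λ β → cong nonzero (*-identityˡ (vpow α β))))
              (levelSum-nonzero-vpow n D α q q≤D)
levelSum-nonzero-vpow (suc n) D (suc a ∷ α) q       q≤D =
  trans (levelSum-suc n D q _ q≤D) (Σ-cong (suc q) (λ b _ →
    trans (levelSum-cong n D (q ∸ b) (nonzero-^-* a b ∘ vpow α))
          (levelSum-nonzero-vpow n D α (q ∸ b) (≤-trans (m∸n≤m q b) q≤D))))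

levelSum-support : ∀ n D (f : ℕ → ℕ) p → p ≤ D →
  levelSum n D p (f ∘ support) ≡ Σ (suc n) (λ k → (n C k) * (compositions k p * f k))
levelSum-support zero    D f zero    _   = cong (_+ 0) (sym (trans (*-identityˡ _) (*-identityˡ (f 0))))
levelSum-support zero    D f (suc p) _   = refl
levelSum-support (suc n) D f p       p≤D = begin
  levelSum (suc n) D p (f ∘ support)
    ≡⟨ levelSum-suc n D p _ p≤D ⟩
  levelSum n D p (f ∘ support) + Σ p (λ a → levelSum n D (p ∸ suc a) (f ∘ suc ∘ support))
    ≡⟨ cong₂ _+_ (levelSum-support n D f p p≤D)
                 (Σ-cong p (λ a _ → levelSum-support n D (f ∘ suc) (p ∸ suc a) (≤-trans (m∸n≤m p (suc a)) p≤D))) ⟩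
  Σ (suc n) (λ k → (n C k) * g k)
    + Σ p (λ a → Σ (suc n) (λ k → (n C k) * (compositions k (p ∸ suc a) * f (suc k))))
    ≡⟨ cong (Σ (suc n) (λ k → (n C k) * g k) +_) (Σ-comm p (suc n) (λ a k → (n C k) * (compositions k (p ∸ suc a) * f (suc k)))) ⟩
  Σ (suc n) (λ k → (n C k) * g k)
    + Σ (suc n) (λ k → Σ p (λ a → (n C k) * (compositions k (p ∸ suc a) * f (suc k))))
    ≡⟨ cong (Σ (suc n) (λ k → (n C k) * g k) +_) (Σ-cong (suc n) (λ k _ → factor k)) ⟩
  Σ (suc n) (λ k → (n C k) * g k) + Σ (suc n) (λ k → (n C k) * g (suc k))
    ≡⟨ Σ-pascal n g ⟩
  Σ (suc (suc n)) (λ k → (suc n C k) * g k) ∎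
  where
  open ≡-Reasoning
  g : ℕ → ℕ
  g k = compositions k p * f k
  factor : ∀ k → Σ p (λ a → (n C k) * (compositions k (p ∸ suc a) * f (suc k))) ≡ (n C k) * g (suc k)
  factor k = sym (trans (cong ((n C k) *_) (*-distribʳ-Σ (f (suc k)) p _))
                        (*-distribˡ-Σ (n C k) p _))

-- The matrix V(n,d)

sum-B : ∀ n D (h : Vec ℕ n → ℕ) → sum (map h (B n D)) ≡ levelSum n D D h
sum-B n D h = sum-map-filter (λ α → vsum α ≟ D) h (boxVecs n D)

|B[1+n,d]|≡[n+d]Cd : ∀ n d → length (B (suc n) d) ≡ (n + d) C d
|B[1+n,d]|≡[n+d]Cd n d = begin
  length (B (suc n) d)                   ≡⟨ length≡sum-map-1 (B (suc n) d) ⟩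
  sum (map (λ _ → 1) (B (suc n) d))      ≡⟨ sum-B (suc n) d (λ _ → 1) ⟩
  levelSum (suc n) d d (λ _ → 1)         ≡⟨ levelSum-1 (suc n) d d ≤-refl ⟩
  weakCompositions (suc n) d             ≡⟨ weakCompositions[1+k,q]≡[q+k]Cq n d ⟩
  (d + n) C d                            ≡⟨ cong (_C d) (+-comm d n) ⟩
  (n + d) C d                            ∎
  where open ≡-Reasoning

nnz-V : ∀ n d → nnz (V n d) ≡ Σ (suc n) (λ k → (n C k) * (compositions k d * weakCompositions k d))
nnz-V n d = begin
  nnz (V n d)
    ≡⟨ cong sum (map-cong (λ i → sum-map-lookup (nonzero ∘ vpow (lookup (B n d) i)) (B n d)) (allFin _)) ⟩
  sum (map (λ i → sum (map (nonzero ∘ vpow (lookup (B n d) i)) (B n d))) (allFin (length (B n d))))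
    ≡⟨ sum-map-lookup (λ α → sum (map (nonzero ∘ vpow α) (B n d))) (B n d) ⟩
  sum (map (λ α → sum (map (nonzero ∘ vpow α) (B n d))) (B n d))
    ≡⟨ sum-B n d _ ⟩
  levelSum n d d (λ α → sum (map (nonzero ∘ vpow α) (B n d)))
    ≡⟨ levelSum-cong n d d (λ α → trans (sum-B n d _) (levelSum-nonzero-vpow n d α d ≤-refl)) ⟩
  levelSum n d d (λ α → weakCompositions (support α) d)
    ≡⟨ levelSum-support n d (λ k → weakCompositions k d) d ≤-refl ⟩
  Σ (suc n) (λ k → (n C k) * (compositions k d * weakCompositions k d)) ∎
  where open ≡-Reasoning

nnz-V[n,1+d] : ∀ n d → nnz (V n (suc d)) ≡ Σ n (λ i → (n C suc i) * (d C i) * ((d + suc i) C suc d))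
nnz-V[n,1+d] n d = trans (nnz-V n (suc d)) (Σ-cong n (λ i _ → closed-form i))
  where
  closed-form : ∀ i → (n C suc i) * (compositions (suc i) (suc d) * weakCompositions (suc i) (suc d))
                        ≡ (n C suc i) * (d C i) * ((d + suc i) C suc d)
  closed-form i = trans
    (cong ((n C suc i) *_) (cong₂ _*_ (compositions[1+k,1+p]≡pCk i d)
      (trans (weakCompositions[1+k,q]≡[q+k]Cq i (suc d)) (cong (_C suc d) (sym (+-suc d i))))))
    (sym (*-assoc (n C suc i) (d C i) _))

[nC[1+i]]*[dCi]≡0 : ∀ n d i → n ⊓ suc d ≤ i → (n C suc i) * (d C i) ≡ 0
[nC[1+i]]*[dCi]≡0 n d i n⊓d′≤i with ⊓-sel n (suc d)
... | inj₁ n⊓d′≡n = cong (_* (d C i)) (k>n⇒nCk≡0 (s≤s (subst (_≤ i) n⊓d′≡n n⊓d′≤i)))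
... | inj₂ n⊓d′≡d′ = trans (cong ((n C suc i) *_) (k>n⇒nCk≡0 (subst (_≤ i) n⊓d′≡d′ n⊓d′≤i))) (*-zeroʳ (n C suc i))

theorem4 : (n d : ℕ) → 1 ≤ n → 1 ≤ d →
    (nnz (V n d) ≡ sum (map (λ i → let k = suc i in (n C k) * ((d ∸ 1) C (k ∸ 1)) * ((d + k ∸ 1) C d)) (upTo (n ⊓ d))))
    × (spa (V n d) ≡ 1ℚ - frac (nnz (V n d)) (((n + d ∸ 1) C d) ^ 2))
theorem4 (suc n) (suc d) (s≤s z≤n) (s≤s z≤n) = nnz-formula , spa-formula
  where
  open ≡-Reasoning
  N = suc n
  D = suc d
  term : ℕ → ℕ
  term i = (N C suc i) * (d C i) * ((d + suc i) C D)
  nnz-formula = begin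
    nnz (V N D)      ≡⟨ nnz-V[n,1+d] N d ⟩
    Σ N term         ≡⟨ Σ-truncate N (N ⊓ D) (m⊓n≤m N D) (λ i le → cong (_* ((d + suc i) C D)) ([nC[1+i]]*[dCi]≡0 N d i le)) ⟩
    Σ (N ⊓ D) term   ≡⟨ sum-map-upTo (N ⊓ D) term ⟨
    sum (map term (upTo (N ⊓ D))) ∎
  spa-formula = cong (λ m → 1ℚ - frac (nnz (V N D)) m)
    (trans (cong (λ m → m * m) (|B[1+n,d]|≡[n+d]Cd n D)) (cong (((n + D) C D) *_) (sym (*-identityʳ ((n + D) C D)))))
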